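{- Let $\mathbb{P}$ and $\mathbb{V}$ be algebraic theories, with $\mathbb{P}$ consistent, let $T_{\mathbb{P}}$ be a stable universal set of $\mathbb{P}$-terms and $T_{\mathbb{V}}$ a stable universal set of $\mathbb{V}$-terms. Suppose there are terms $2 \vdash_{\mathbb{P}} p$ and $2 \vdash_{\mathbb{V}} v$ such that: (P1) $2 \vdash p(1,2) =_{\mathbb{P}} p(2,1)$; (P2) $1 \vdash p(1,1) =_{\mathbb{P}} 1$; (P3) for all $p' \in T_{\mathbb{P}}$ and every context $\Gamma$: if $\Gamma \vdash p(1,2) =_{\mathbb{P}} p'$ then $2 \vdash p'$; (V1) $1 \vdash v(1,1) =_{\mathbb{V}} 1$; (V2) for all $v' \in T_{\mathbb{V}}$ and every variable $x$: if $\Gamma \vdash x =_{\mathbb{V}} v'$ then $\{x\} \vdash v'$; (V3) for all $v' \in T_{\mathbb{V}}$: if $\Gamma \vdash v(1,2) =_{\mathbb{V}} v'$ then neither $\{1\} \vdash v'$ nor $\{2\} \vdash v'$. Then there is no composite theory of $\mathbb{P}$ after $\mathbb{V}$.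
   Context: An algebraic theory consists of a signature and equations; $u =_{\mathbb T} w$ means provable in equational logic. Variables are natural numbers, and the number $n$ also denotes the set $\{1,\dots,n\}$. $Y \vdash t$ means all variables of $t$ lie in $Y$; $\Gamma$ denotes an arbitrary variable context. For $2\vdash p$, $p(a,b)$ denotes $p$ with $a$ substituted for $1$ and $b$ for $2$. A theory is consistent if it does not prove $x=y$ for distinct variables. A set of terms of a theory is universal if every term is provably equal to a member of it, and stable if it is closed under substituting variables for variables. For theories $\mathbb{S},\mathbb{T}$ (here $\mathbb{T}=\mathbb{P}$ and $\mathbb{S}=\mathbb{V}$): a theory $\mathbb{U}$ contains them if its signature contains both signatures and all their equations are provable in $\mathbb{U}$; a $\mathbb{U}$-term is separated if it has the form $t[s_x/x]$ (simultaneous substitution) with $t$ a $\mathbb{T}$-term with variables in $X$ and each $s_x$ an $\mathbb{S}$-term; separated terms $t[s_x/x]$, $t'[s'_{x'}/x']$ (variables of $t,t'$ in $X,X'$) are equal modulo $(\mathbb{T},\mathbb{S})$ if there are $f:X\to Y$, $f':X'\to Y$ and $\mathbb{S}$-terms $\bar s_y$ with $t[f(x)/x]=_{\mathbb T}t'[f'(x')/x']$, $s_x=_{\mathbb S}\bar s_{f(x)}$, $s'_{x'}=_{\mathbb S}\bar s_{f'(x')}$. $\mathbb{U}$ is a composite theory of $\mathbb{T}$ after $\mathbb{S}$ if every $\mathbb{U}$-term is $\mathbb U$-equal to a separated term and any two separated terms $\mathbb{U}$-equal to a common term are equal modulo $(\mathbb{T},\mathbb{S})$. -}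

module Defs where

open import Data.Nat using (ℕ; _≤_)
open import Data.Fin using (Fin; cast)
open import Data.Product using (Σ; ∃; _×_; _,_)
open import Data.Sum using (_⊎_)
open import Relation.Binary.PropositionalEquality using (_≡_; _≢_)
open import Relation.Nullary using (¬_)
open import Function.Definitions using (Injective)

record Signature : Set₁ where
  field
    Op    : Set
    arity : Op → ℕ
open Signature public

data Term (S : Signature) : Set where
  var : ℕ → Term S
  op  : (o : Op S) → (Fin (arity S o) → Term S) → Term S

subst : {S : Signature} → (ℕ → Term S) → Term S → Term S
subst σ (var x)   = σ x
subst σ (op o ts) = op o (λ i → subst σ (ts i))

rename : {S : Signature} → (ℕ → ℕ) → Term S → Term S
rename f = subst (λ x → var (f x))

data _occursIn_ {S : Signature} (x : ℕ) : Term S → Set where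
  here  : x occursIn var x
  under : {o : Op S} {ts : Fin (arity S o) → Term S} (i : Fin (arity S o)) →
          x occursIn ts i → x occursIn op o ts

_⊢ˢ_ : {S : Signature} → (ℕ → Set) → Term S → Set
Y ⊢ˢ t = ∀ x → x occursIn t → Y x

infix 4 _⊢_
_⊢_ : {S : Signature} → ℕ → Term S → Set
n ⊢ t = (λ x → 1 ≤ x × x ≤ n) ⊢ˢ t

[_]⊢_ : {S : Signature} → ℕ → Term S → Set
[ x ]⊢ t = (λ y → y ≡ x) ⊢ˢ t

σ₂ : {S : Signature} → Term S → Term S → ℕ → Term S
σ₂ a b 1 = a
σ₂ a b 2 = b
σ₂ a b x = var x

infix 30 _⟨_,_⟩
_⟨_,_⟩ : {S : Signature} → Term S → Term S → Term S → Term S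
p ⟨ a , b ⟩ = subst (σ₂ a b) p

record Theory : Set₁ where
  field
    sig : Signature
    Ax  : Set
    lhs : Ax → Term sig
    rhs : Ax → Term sig
open Theory public

TermOf : Theory → Set
TermOf T = Term (sig T)

infix 4 _⊢_≈_
data _⊢_≈_ (T : Theory) : TermOf T → TermOf T → Set where
  ≈-refl  : ∀ {u} → T ⊢ u ≈ u
  ≈-sym   : ∀ {u w} → T ⊢ u ≈ w → T ⊢ w ≈ u
  ≈-trans : ∀ {u w z} → T ⊢ u ≈ w → T ⊢ w ≈ z → T ⊢ u ≈ z
  ≈-cong  : ∀ (o : Op (sig T)) {ts us : Fin (arity (sig T) o) → TermOf T} →
            (∀ i → T ⊢ ts i ≈ us i) → T ⊢ op o ts ≈ op o us
  ≈-ax    : ∀ (a : Ax T) (σ : ℕ → TermOf T) →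
            T ⊢ subst σ (lhs T a) ≈ subst σ (rhs T a)

Consistent : Theory → Set
Consistent T = ∀ (x y : ℕ) → x ≢ y → ¬ (T ⊢ var x ≈ var y)

TermSet : Theory → Set₁
TermSet T = TermOf T → Set

Universal : (T : Theory) → TermSet T → Set
Universal T A = ∀ (t : TermOf T) → ∃ λ t' → A t' × T ⊢ t ≈ t'

Stable : (T : Theory) → TermSet T → Set
Stable T A = ∀ (t : TermOf T) (f : ℕ → ℕ) → A t → A (rename f t)

record _⊆Sig_ (S S' : Signature) : Set where
  field
    ι       : Op S → Op S'
    ι-arity : ∀ o → arity S' (ι o) ≡ arity S o
    ι-inj   : Injective _≡_ _≡_ ι
open _⊆Sig_ public

translate : {S S' : Signature} → S ⊆Sig S' → Term S → Term S'
translate e (var x)   = var x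
translate e (op o ts) = op (ι e o) (λ i → translate e (ts (cast (ι-arity e o) i)))

record _⊆Th_ (T U : Theory) : Set where
  field
    sigIncl : sig T ⊆Sig sig U
    axProv  : ∀ (a : Ax T) →
              U ⊢ translate sigIncl (lhs T a) ≈ translate sigIncl (rhs T a)
open _⊆Th_ public

-- A separated term t[s_x/x]: t a T-term, s_x an S-term for each variable x
-- (only the s_x for variables x of t are relevant).
record Separated (T S : Theory) : Set where
  constructor sep
  field
    tpart : TermOf T
    spart : ℕ → TermOf S
open Separated public

EqMod : (T S : Theory) → Separated T S → Separated T S → Set
EqMod T S (sep t s) (sep t' s') =
  Σ (ℕ → ℕ) λ f → Σ (ℕ → ℕ) λ f' → Σ (ℕ → TermOf S) λ s̄ →
    (T ⊢ rename f t ≈ rename f' t')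
    × (∀ x → x occursIn t → S ⊢ s x ≈ s̄ (f x))
    × (∀ x → x occursIn t' → S ⊢ s' x ≈ s̄ (f' x))

record IsComposite (T S U : Theory) : Set where
  field
    containsT : T ⊆Th U
    containsS : S ⊆Th U
  ⟦_⟧ : Separated T S → TermOf U
  ⟦ sep t s ⟧ = subst (λ x → translate (sigIncl containsS) (s x))
                      (translate (sigIncl containsT) t)
  field
    separation : ∀ (u : TermOf U) → ∃ λ (r : Separated T S) → U ⊢ u ≈ ⟦ r ⟧
    uniqueness : ∀ (u : TermOf U) (r r' : Separated T S) →
                 U ⊢ u ≈ ⟦ r ⟧ → U ⊢ u ≈ ⟦ r' ⟧ → EqMod T S r r'

{-# OPTIONS --safe #-}
-- Take u := v(p(1,2), p(3,4)) in a composite theory U. Overlaying (3,4) on (1,2) sends u to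
-- p(1,2) by (V1); overlaying it on (2,1) does too, by (P1); merging {1,2} and {3,4} sends it to
-- v(p(1,1), p(2,2)) = v(1,2) by (P2). Write u in separated form t[s_x/x] with t ∈ T_P and
-- s_x ∈ T_V. Uniqueness of separated forms, compared against p[1/1,2/2], together with (P3) and
-- (V2) forces both overlays of each s_x to be single variables; hence all variables z of s_x
-- agree on whether their two overlays coincide, so merging turns s_x into a term in one variable.
-- Compared against 1[v/1], uniqueness and consistency of P make v(1,2) provably equal to the
-- merge of some s_x, contradicting (V3).
module Submission where

open import Defs
open import Data.Nat using (ℕ; suc; _≤_; z≤n; s≤s; _≟_)
open import Data.Nat.Properties using (1+n≢n)
open import Data.Fin using (cast)
open import Data.Fin.Properties using (any?)
open import Data.Product using (_×_; _,_; ∃-syntax; proj₁; proj₂)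
open import Data.Sum using (_⊎_; inj₁; inj₂; [_,_]′)
open import Data.Empty using (⊥; ⊥-elim)
open import Function using (_∘_)
open import Relation.Nullary using (¬_; Dec; yes; no)
open import Relation.Nullary.Decidable using (map′; decidable-stable)
open import Relation.Binary.Bundles using (Setoid)
open import Relation.Binary.PropositionalEquality using (_≡_; _≢_; refl; sym; trans; cong)
  renaming (subst to ≡-subst)
import Relation.Binary.Reasoning.Setoid as SetoidReasoning

private
  variable
    S S′ : Signature
    T U : Theory
    x y k : ℕ

occursIn-subst : (t : Term S) (σ : ℕ → Term S) →
                 x occursIn t → y occursIn σ x → y occursIn subst σ t
occursIn-subst (var x)   σ here         oc = oc
occursIn-subst (op o ts) σ (under i ox) oc = under i (occursIn-subst (ts i) σ ox oc)

occursIn-subst⁻ : (t : Term S) (σ : ℕ → Term S) →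
                  y occursIn subst σ t → ∃[ x ] x occursIn t × y occursIn σ x
occursIn-subst⁻ (var x)   σ oc = x , here , oc
occursIn-subst⁻ (op o ts) σ (under i oc) with occursIn-subst⁻ (ts i) σ oc
... | x , ox , oy = x , under i ox , oy

occursIn-rename⁻ : (t : Term S) (f : ℕ → ℕ) →
                   y occursIn rename f t → ∃[ x ] x occursIn t × y ≡ f x
occursIn-rename⁻ t f oc with occursIn-subst⁻ t (var ∘ f) oc
... | x , ox , here = x , ox , refl

occursIn-translate⁻ : (e : S ⊆Sig S′) (t : Term S) → x occursIn translate e t → x occursIn t
occursIn-translate⁻ e (var x)   here         = here
occursIn-translate⁻ e (op o ts) (under i oc) =
  under (cast (ι-arity e o) i) (occursIn-translate⁻ e (ts (cast (ι-arity e o) i)) oc)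

_occursIn?_ : (x : ℕ) (t : Term S) → Dec (x occursIn t)
x occursIn? var y with x ≟ y
... | yes refl = yes here
... | no x≢y   = no λ { here → x≢y refl }
x occursIn? op o ts =
  map′ (λ (i , oc) → under i oc) (λ { (under i oc) → i , oc }) (any? λ i → x occursIn? ts i)

⊢ˢ-translate : {Y : ℕ → Set} (e : S ⊆Sig S′) (t : Term S) → Y ⊢ˢ t → Y ⊢ˢ translate e t
⊢ˢ-translate e t Y⊢t x oc = Y⊢t x (occursIn-translate⁻ e t oc)

[]⊢-rename : (t : Term S) (f : ℕ → ℕ) → (∀ z → z occursIn t → f z ≡ k) → [ k ]⊢ rename f t
[]⊢-rename t f fz≡k y oy with occursIn-rename⁻ t f oy
... | z , oz , refl = fz≡k z oz

[]⊢-rename⁻ : (t : Term S) (f : ℕ → ℕ) → [ k ]⊢ rename f t → ∀ z → z occursIn t → f z ≡ k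
[]⊢-rename⁻ t f k⊢ z oz = k⊢ (f z) (occursIn-subst t (var ∘ f) oz here)

≤2⇒≡1⊎≡2 : 1 ≤ x × x ≤ 2 → x ≡ 1 ⊎ x ≡ 2
≤2⇒≡1⊎≡2 (s≤s z≤n , s≤s z≤n)       = inj₁ refl
≤2⇒≡1⊎≡2 (s≤s z≤n , s≤s (s≤s z≤n)) = inj₂ refl

classify : ℕ → ℕ → ℕ → ℕ
classify a b z with z ≟ a
... | yes _ = 1
... | no _ with z ≟ b
...   | yes _ = 2
...   | no _  = 3

classify-≡₁ : ∀ a b → classify a b a ≡ 1
classify-≡₁ a b with a ≟ a
... | yes _  = refl
... | no a≢a = ⊥-elim (a≢a refl)

classify-≡₂ : ∀ {a} b → a ≢ b → classify a b b ≡ 2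
classify-≡₂ {a} b a≢b with b ≟ a
... | yes b≡a = ⊥-elim (a≢b (sym b≡a))
... | no _ with b ≟ b
...   | yes _  = refl
...   | no b≢b = ⊥-elim (b≢b refl)

classify-≤2 : ∀ a b z → classify a b z ≤ 2 → z ≡ a ⊎ z ≡ b
classify-≤2 a b z le with z ≟ a
... | yes z≡a = inj₁ z≡a
... | no _ with z ≟ b
...   | yes z≡b = inj₂ z≡b
classify-≤2 a b z (s≤s (s≤s ())) | no _ | no _

agreement : (ℕ → ℕ) → (ℕ → ℕ) → ℕ → ℕ
agreement f g z with f z ≟ g z
... | yes _ = 1
... | no _  = 2

agreement-≡ : ∀ {f g} z → f z ≡ g z → agreement f g z ≡ 1
agreement-≡ {f} {g} z fz≡gz with f z ≟ g z
... | yes _     = refl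
... | no fz≢gz = ⊥-elim (fz≢gz fz≡gz)

agreement-≢ : ∀ {f g} z → f z ≢ g z → agreement f g z ≡ 2
agreement-≢ {f} {g} z fz≢gz with f z ≟ g z
... | yes fz≡gz = ⊥-elim (fz≢gz fz≡gz)
... | no _      = refl

[]⊢-agreement : ∀ {i j} (t : Term S) (f g : ℕ → ℕ) → [ i ]⊢ rename f t → [ j ]⊢ rename g t →
                [ 1 ]⊢ rename (agreement f g) t ⊎ [ 2 ]⊢ rename (agreement f g) t
[]⊢-agreement {i = i} {j} t f g i⊢ft j⊢gt = by-cases (i ≟ j)
  where
    fz≡i : ∀ z → z occursIn t → f z ≡ i
    fz≡i = []⊢-rename⁻ t f i⊢ft
    gz≡j : ∀ z → z occursIn t → g z ≡ j
    gz≡j = []⊢-rename⁻ t g j⊢gt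
    by-cases : Dec (i ≡ j) → [ 1 ]⊢ rename (agreement f g) t ⊎ [ 2 ]⊢ rename (agreement f g) t
    by-cases (yes refl) = inj₁ ([]⊢-rename t _ λ z z∈t →
      agreement-≡ z (trans (fz≡i z z∈t) (sym (gz≡j z z∈t))))
    by-cases (no i≢j)   = inj₂ ([]⊢-rename t _ λ z z∈t → agreement-≢ z λ fz≡gz →
      i≢j (trans (sym (fz≡i z z∈t)) (trans fz≡gz (gz≡j z z∈t))))

≈-setoid : Theory → Setoid _ _
≈-setoid T = record
  { Carrier       = TermOf T
  ; _≈_           = T ⊢_≈_
  ; isEquivalence = record { refl = ≈-refl ; sym = ≈-sym ; trans = ≈-trans }
  }

module ≈-Reasoning (T : Theory) = SetoidReasoning (≈-setoid T)

≡⇒≈ : {a b : TermOf T} → a ≡ b → T ⊢ a ≈ b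
≡⇒≈ refl = ≈-refl

subst-cong : (t : TermOf T) {σ τ : ℕ → TermOf T} →
             (∀ x → x occursIn t → T ⊢ σ x ≈ τ x) → T ⊢ subst σ t ≈ subst τ t
subst-cong (var x)   σ≈τ = σ≈τ x here
subst-cong (op o ts) σ≈τ = ≈-cong o λ i → subst-cong (ts i) λ x oc → σ≈τ x (under i oc)

subst-∘ : (t : TermOf T) (σ τ : ℕ → TermOf T) →
          T ⊢ subst σ (subst τ t) ≈ subst (subst σ ∘ τ) t
subst-∘ (var x)   σ τ = ≈-refl
subst-∘ (op o ts) σ τ = ≈-cong o λ i → subst-∘ (ts i) σ τ

subst-var : (t : TermOf T) → T ⊢ subst var t ≈ t
subst-var (var x)   = ≈-refl
subst-var (op o ts) = ≈-cong o λ i → subst-var (ts i)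

≈-subst : {a b : TermOf T} (σ : ℕ → TermOf T) → T ⊢ a ≈ b → T ⊢ subst σ a ≈ subst σ b
≈-subst σ ≈-refl           = ≈-refl
≈-subst σ (≈-sym e)        = ≈-sym (≈-subst σ e)
≈-subst σ (≈-trans e e′)   = ≈-trans (≈-subst σ e) (≈-subst σ e′)
≈-subst σ (≈-cong o es)    = ≈-cong o λ i → ≈-subst σ (es i)
≈-subst {T} σ (≈-ax a τ) = begin
  subst σ (subst τ (lhs T a)) ≈⟨ subst-∘ (lhs T a) σ τ ⟩
  subst (subst σ ∘ τ) (lhs T a) ≈⟨ ≈-ax a (subst σ ∘ τ) ⟩
  subst (subst σ ∘ τ) (rhs T a) ≈⟨ subst-∘ (rhs T a) σ τ ⟨
  subst σ (subst τ (rhs T a)) ∎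
  where open ≈-Reasoning T

rename-fixing : (t : TermOf T) (f : ℕ → ℕ) → (∀ z → z occursIn t → f z ≡ z) → T ⊢ rename f t ≈ t
rename-fixing t f fz≡z = ≈-trans (subst-cong t λ z oz → ≡⇒≈ (cong var (fz≡z z oz))) (subst-var t)

redirect : ℕ → ℕ → ℕ → ℕ
redirect y y′ z with z ≟ y
... | yes _ = y′
... | no _  = z

redirect-≡ : ∀ y y′ → redirect y y′ y ≡ y′
redirect-≡ y y′ with y ≟ y
... | yes _  = refl
... | no y≢y = ⊥-elim (y≢y refl)

redirect-≢ : ∀ {y} y′ z → z ≢ y → redirect y y′ z ≡ z
redirect-≢ {y} y′ z z≢y with z ≟ y
... | yes z≡y = ⊥-elim (z≢y z≡y)
... | no _    = refl

-- If y did not occur in b, redirecting y to suc y would fix b and so prove var (suc y) ≈ var y.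
var≈⇒occursIn : Consistent T → {b : TermOf T} → T ⊢ var y ≈ b → y occursIn b
var≈⇒occursIn {T} {y} consistent {b} y≈b = decidable-stable (y occursIn? b) λ y∉b →
  consistent (suc y) y 1+n≢n (begin
    var (suc y)                         ≡⟨ cong var (redirect-≡ y (suc y)) ⟨
    rename (redirect y (suc y)) (var y) ≈⟨ ≈-subst _ y≈b ⟩
    rename (redirect y (suc y)) b       ≈⟨ rename-fixing b _ (fixes-b y∉b) ⟩
    b                                   ≈⟨ y≈b ⟨
    var y                               ∎)
    where
      open ≈-Reasoning T
      fixes-b : ¬ y occursIn b → ∀ z → z occursIn b → redirect y (suc y) z ≡ z
      fixes-b y∉b z z∈b = redirect-≢ (suc y) z λ z≡y → y∉b (≡-subst (_occursIn b) z≡y z∈b)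

module _ {T : Theory} {q : TermOf T} (2⊢q : 2 ⊢ q) where
  open ≈-Reasoning T

  subst-cong₂ : {σ τ : ℕ → TermOf T} →
                (1 occursIn q → T ⊢ σ 1 ≈ τ 1) → (2 occursIn q → T ⊢ σ 2 ≈ τ 2) →
                T ⊢ subst σ q ≈ subst τ q
  subst-cong₂ {σ} {τ} σ₁≈τ₁ σ₂≈τ₂ = subst-cong q λ x ox → agree x (≤2⇒≡1⊎≡2 (2⊢q x ox)) ox
    where
      agree : ∀ x → x ≡ 1 ⊎ x ≡ 2 → x occursIn q → T ⊢ σ x ≈ τ x
      agree .1 (inj₁ refl) = σ₁≈τ₁
      agree .2 (inj₂ refl) = σ₂≈τ₂

  subst-binary : (σ : ℕ → TermOf T) → T ⊢ subst σ q ≈ q ⟨ σ 1 , σ 2 ⟩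
  subst-binary σ = subst-cong₂ (λ _ → ≈-refl) (λ _ → ≈-refl)

  ⟨⟩-cong : {a a′ b b′ : TermOf T} → T ⊢ a ≈ a′ → T ⊢ b ≈ b′ → T ⊢ q ⟨ a , b ⟩ ≈ q ⟨ a′ , b′ ⟩
  ⟨⟩-cong a≈a′ b≈b′ = subst-cong₂ (λ _ → a≈a′) (λ _ → b≈b′)

  ⟨1,2⟩-id : T ⊢ q ⟨ var 1 , var 2 ⟩ ≈ q
  ⟨1,2⟩-id = ≈-trans (≈-sym (subst-binary var)) (subst-var q)

  subst-⟨⟩ : (σ : ℕ → TermOf T) (a b : TermOf T) →
             T ⊢ subst σ (q ⟨ a , b ⟩) ≈ q ⟨ subst σ a , subst σ b ⟩
  subst-⟨⟩ σ a b = ≈-trans (subst-∘ q σ (σ₂ a b)) (subst-binary (subst σ ∘ σ₂ a b))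

  ⟨⟩-idem : T ⊢ q ⟨ var 1 , var 1 ⟩ ≈ var 1 → (a : TermOf T) → T ⊢ q ⟨ a , a ⟩ ≈ a
  ⟨⟩-idem idem a = ≈-trans (≈-sym (subst-⟨⟩ (λ _ → a) (var 1) (var 1))) (≈-subst (λ _ → a) idem)

  module _ (consistent : Consistent T)
           (comm : T ⊢ q ⟨ var 1 , var 2 ⟩ ≈ q ⟨ var 2 , var 1 ⟩)
           (idem : T ⊢ q ⟨ var 1 , var 1 ⟩ ≈ var 1) where

    comm-idem⇒1-occurs : 1 occursIn q
    comm-idem⇒1-occurs = decidable-stable (1 occursIn? q) λ 1∉q →
      consistent 2 1 (λ ()) (begin
        var 2               ≈⟨ ⟨⟩-idem idem (var 2) ⟨
        q ⟨ var 2 , var 2 ⟩ ≈⟨ subst-cong₂ (⊥-elim ∘ 1∉q) (λ _ → ≈-refl) ⟩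
        q ⟨ var 1 , var 2 ⟩ ≈⟨ comm ⟩
        q ⟨ var 2 , var 1 ⟩ ≈⟨ subst-cong₂ (⊥-elim ∘ 1∉q) (λ _ → ≈-refl) ⟩
        q ⟨ var 1 , var 1 ⟩ ≈⟨ idem ⟩
        var 1               ∎)

    comm-idem⇒2-occurs : 2 occursIn q
    comm-idem⇒2-occurs = decidable-stable (2 occursIn? q) λ 2∉q →
      consistent 1 2 (λ ()) (begin
        var 1               ≈⟨ idem ⟨
        q ⟨ var 1 , var 1 ⟩ ≈⟨ subst-cong₂ (λ _ → ≈-refl) (⊥-elim ∘ 2∉q) ⟩
        q ⟨ var 1 , var 2 ⟩ ≈⟨ comm ⟩
        q ⟨ var 2 , var 1 ⟩ ≈⟨ subst-cong₂ (λ _ → ≈-refl) (⊥-elim ∘ 2∉q) ⟩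
        q ⟨ var 2 , var 2 ⟩ ≈⟨ ⟨⟩-idem idem (var 2) ⟩
        var 2               ∎)

translate-subst : (e : S ⊆Sig sig U) (t : Term S) (σ : ℕ → Term S) →
                  U ⊢ translate e (subst σ t) ≈ subst (translate e ∘ σ) (translate e t)
translate-subst e (var x)   σ = ≈-refl
translate-subst e (op o ts) σ = ≈-cong (ι e o) λ i → translate-subst e (ts (cast (ι-arity e o) i)) σ

translate-≈ : (c : T ⊆Th U) {a b : TermOf T} →
              T ⊢ a ≈ b → U ⊢ translate (sigIncl c) a ≈ translate (sigIncl c) b
translate-≈ c ≈-refl         = ≈-refl
translate-≈ c (≈-sym e)      = ≈-sym (translate-≈ c e)
translate-≈ c (≈-trans e e′) = ≈-trans (translate-≈ c e) (translate-≈ c e′)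
translate-≈ c (≈-cong o es)  =
  ≈-cong (ι (sigIncl c) o) λ i → translate-≈ c (es (cast (ι-arity (sigIncl c) o) i))
translate-≈ {T} {U} c (≈-ax a σ) = begin
  translate e (subst σ (lhs T a))        ≈⟨ translate-subst e (lhs T a) σ ⟩
  subst (translate e ∘ σ) (translate e (lhs T a)) ≈⟨ ≈-subst _ (axProv c a) ⟩
  subst (translate e ∘ σ) (translate e (rhs T a)) ≈⟨ translate-subst e (rhs T a) σ ⟨
  translate e (subst σ (rhs T a))        ∎
  where
    open ≈-Reasoning U
    e : sig T ⊆Sig sig U
    e = sigIncl c

translate-⟨⟩ : (e : S ⊆Sig sig U) {q : Term S} → 2 ⊢ q → (a b : Term S) →
               U ⊢ translate e (q ⟨ a , b ⟩) ≈ translate e q ⟨ translate e a , translate e b ⟩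
translate-⟨⟩ e {q} 2⊢q a b =
  ≈-trans (translate-subst e q (σ₂ a b)) (subst-binary (⊢ˢ-translate e q 2⊢q) _)

universal-pointwise : {A : TermSet T} → Universal T A → (f : ℕ → TermOf T) →
                      ∃[ g ] (∀ x → A (g x)) × (∀ x → T ⊢ f x ≈ g x)
universal-pointwise universal f =
  (λ x → proj₁ (universal (f x))) , (λ x → proj₁ (proj₂ (universal (f x)))) ,
  (λ x → proj₂ (proj₂ (universal (f x))))

module Composite {T S U : Theory} (C : IsComposite T S U) where
  open IsComposite C public using (containsT; containsS; ⟦_⟧; uniqueness)

  T̂ : TermOf T → TermOf U
  T̂ = translate (sigIncl containsT)

  Ŝ : TermOf S → TermOf U
  Ŝ = translate (sigIncl containsS)

  T̂-≈ : {a b : TermOf T} → T ⊢ a ≈ b → U ⊢ T̂ a ≈ T̂ b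
  T̂-≈ = translate-≈ containsT

  Ŝ-≈ : {a b : TermOf S} → S ⊢ a ≈ b → U ⊢ Ŝ a ≈ Ŝ b
  Ŝ-≈ = translate-≈ containsS

  separation-within : {A : TermSet T} {B : TermSet S} → Universal T A → Universal S B →
                      (u : TermOf U) → ∃[ t ] ∃[ s ] A t × (∀ x → B (s x)) × U ⊢ u ≈ ⟦ sep t s ⟧
  separation-within universalA universalB u with IsComposite.separation C u
  ... | sep t₀ s₀ , u≈ with universalA t₀ | universal-pointwise universalB s₀
  ... | t , t∈A , t₀≈t | s , s∈B , s₀≈s = t , s , t∈A , s∈B , (begin
    u                        ≈⟨ u≈ ⟩
    subst (Ŝ ∘ s₀) (T̂ t₀)    ≈⟨ ≈-subst _ (T̂-≈ t₀≈t) ⟩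
    subst (Ŝ ∘ s₀) (T̂ t)     ≈⟨ subst-cong (T̂ t) (λ x _ → Ŝ-≈ (s₀≈s x)) ⟩
    subst (Ŝ ∘ s) (T̂ t)      ∎)
    where open ≈-Reasoning U

  ⟦⟧-rename : (t : TermOf T) (s : ℕ → TermOf S) (f : ℕ → ℕ) →
              U ⊢ rename f ⟦ sep t s ⟧ ≈ ⟦ sep t (rename f ∘ s) ⟧
  ⟦⟧-rename t s f = ≈-trans (subst-∘ (T̂ t) (var ∘ f) (Ŝ ∘ s))
    (subst-cong (T̂ t) λ x _ → ≈-sym (translate-subst (sigIncl containsS) (s x) (var ∘ f)))

  -- Compared with the separated form 1[w/1]; consistency of T makes the image of 1 occur in t.
  ⟦⟧≈Ŝ⇒component : Consistent T → (t : TermOf T) (s : ℕ → TermOf S) {w : TermOf S} →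
                   U ⊢ ⟦ sep t s ⟧ ≈ Ŝ w → ∃[ x ] x occursIn t × S ⊢ w ≈ s x
  ⟦⟧≈Ŝ⇒component consistent t s {w} ts≈w
    with uniqueness ⟦ sep t s ⟧ (sep t s) (sep (var 1) λ _ → w) ≈-refl ts≈w
  ... | f , f′ , s̄ , ft≈f′1 , s≈s̄ , w≈s̄
    with occursIn-rename⁻ t f (var≈⇒occursIn consistent (≈-sym ft≈f′1))
  ... | x , x∈t , f′1≡fx =
    x , x∈t , ≈-trans (w≈s̄ 1 here) (≈-trans (≡⇒≈ (cong s̄ f′1≡fx)) (≈-sym (s≈s̄ x x∈t)))

module _ {P : Theory} {TP : TermSet P} (stable : Stable P TP) {p : TermOf P} (2⊢p : 2 ⊢ p)
         (P3 : ∀ p′ → TP p′ → P ⊢ p ⟨ var 1 , var 2 ⟩ ≈ p′ → 2 ⊢ p′) where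

  -- Renaming g′ 1, g′ 2 back to 1, 2 turns rename g t into a representative of p(1,2).
  rename≈rename-p⇒image : {t : TermOf P} → TP t → {g g′ : ℕ → ℕ} →
                          P ⊢ rename g t ≈ rename g′ p → g′ 1 ≢ g′ 2 →
                          ∀ {x} → x occursIn t → g x ≡ g′ 1 ⊎ g x ≡ g′ 2
  rename≈rename-p⇒image {t} t∈TP {g} {g′} gt≈g′p g′1≢g′2 {x} x∈t =
    classify-≤2 (g′ 1) (g′ 2) (g x) (proj₂ (2⊢hgt (h (g x)) hgx∈hgt))
    where
      open ≈-Reasoning P
      h : ℕ → ℕ
      h = classify (g′ 1) (g′ 2)
      hg′1≡1 : h (g′ 1) ≡ 1
      hg′1≡1 = classify-≡₁ (g′ 1) (g′ 2)
      hg′2≡2 : h (g′ 2) ≡ 2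
      hg′2≡2 = classify-≡₂ (g′ 2) g′1≢g′2
      p≈hgt : P ⊢ p ⟨ var 1 , var 2 ⟩ ≈ rename h (rename g t)
      p≈hgt = begin
        p ⟨ var 1 , var 2 ⟩
          ≈⟨ ⟨⟩-cong 2⊢p (≡⇒≈ (cong var hg′1≡1)) (≡⇒≈ (cong var hg′2≡2)) ⟨
        p ⟨ var (h (g′ 1)) , var (h (g′ 2)) ⟩
          ≈⟨ subst-binary 2⊢p (var ∘ h ∘ g′) ⟨
        rename (h ∘ g′) p
          ≈⟨ subst-∘ p (var ∘ h) (var ∘ g′) ⟨
        rename h (rename g′ p)
          ≈⟨ ≈-subst (var ∘ h) gt≈g′p ⟨
        rename h (rename g t)
          ∎
      2⊢hgt : 2 ⊢ rename h (rename g t)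
      2⊢hgt = P3 _ (stable _ h (stable t g t∈TP)) p≈hgt
      hgx∈hgt : h (g x) occursIn rename h (rename g t)
      hgx∈hgt = occursIn-subst (rename g t) (var ∘ h) (occursIn-subst t (var ∘ g) x∈t here) here

overlay : ℕ → ℕ
overlay 3 = 1
overlay 4 = 2
overlay z = z

cross : ℕ → ℕ
cross 3 = 2
cross 4 = 1
cross z = z

-- Among 1, 2, 3, 4, overlay and cross agree exactly on 1 and 2, so merge identifies 1 with 2
-- and 3 with 4.
merge : ℕ → ℕ
merge = agreement overlay cross

module NoComposite
  (P V : Theory) (consistent : Consistent P)
  (TP : TermSet P) (stableP : Stable P TP) (universalP : Universal P TP)
  (TV : TermSet V) (stableV : Stable V TV) (universalV : Universal V TV)
  (p : TermOf P) (2⊢p : 2 ⊢ p) (v : TermOf V) (2⊢v : 2 ⊢ v)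
  (P1 : P ⊢ p ⟨ var 1 , var 2 ⟩ ≈ p ⟨ var 2 , var 1 ⟩)
  (P2 : P ⊢ p ⟨ var 1 , var 1 ⟩ ≈ var 1)
  (P3 : ∀ p′ → TP p′ → P ⊢ p ⟨ var 1 , var 2 ⟩ ≈ p′ → 2 ⊢ p′)
  (V1 : V ⊢ v ⟨ var 1 , var 1 ⟩ ≈ var 1)
  (V2 : ∀ v′ → TV v′ → ∀ (x : ℕ) → V ⊢ var x ≈ v′ → [ x ]⊢ v′)
  (V3 : ∀ v′ → TV v′ → V ⊢ v ⟨ var 1 , var 2 ⟩ ≈ v′ → ¬ ([ 1 ]⊢ v′) × ¬ ([ 2 ]⊢ v′))
  (U : Theory) (C : IsComposite P V U)
  where

  open Composite C
  open ≈-Reasoning U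

  var₁≉var₂ : ¬ V ⊢ var 1 ≈ var 2
  var₁≉var₂ 1≈2 with universalV (var 1)
  ... | v′ , v′∈TV , 1≈v′ = proj₁ (V3 v′ v′∈TV v≈v′) (V2 v′ v′∈TV 1 1≈v′)
    where
      v≈v′ : V ⊢ v ⟨ var 1 , var 2 ⟩ ≈ v′
      v≈v′ = ≈-trans (⟨⟩-cong 2⊢v ≈-refl (≈-sym 1≈2)) (≈-trans V1 1≈v′)

  p̂ : TermOf U
  p̂ = T̂ p

  v̂ : TermOf U
  v̂ = Ŝ v

  2⊢p̂ : 2 ⊢ p̂
  2⊢p̂ = ⊢ˢ-translate _ p 2⊢p

  2⊢v̂ : 2 ⊢ v̂
  2⊢v̂ = ⊢ˢ-translate _ v 2⊢v

  p̂-comm : U ⊢ p̂ ⟨ var 1 , var 2 ⟩ ≈ p̂ ⟨ var 2 , var 1 ⟩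
  p̂-comm = ≈-trans (≈-sym (translate-⟨⟩ _ 2⊢p (var 1) (var 2)))
             (≈-trans (T̂-≈ P1) (translate-⟨⟩ _ 2⊢p (var 2) (var 1)))

  p̂-idem : U ⊢ p̂ ⟨ var 1 , var 1 ⟩ ≈ var 1
  p̂-idem = ≈-trans (≈-sym (translate-⟨⟩ _ 2⊢p (var 1) (var 1))) (T̂-≈ P2)

  v̂-idem : U ⊢ v̂ ⟨ var 1 , var 1 ⟩ ≈ var 1
  v̂-idem = ≈-trans (≈-sym (translate-⟨⟩ _ 2⊢v (var 1) (var 1))) (Ŝ-≈ V1)

  u : TermOf U
  u = v̂ ⟨ p̂ ⟨ var 1 , var 2 ⟩ , p̂ ⟨ var 3 , var 4 ⟩ ⟩

  rename-u : (f : ℕ → ℕ) →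
             U ⊢ rename f u ≈ v̂ ⟨ p̂ ⟨ var (f 1) , var (f 2) ⟩ , p̂ ⟨ var (f 3) , var (f 4) ⟩ ⟩
  rename-u f = ≈-trans (subst-⟨⟩ 2⊢v̂ (var ∘ f) _ _)
                       (⟨⟩-cong 2⊢v̂ (subst-⟨⟩ 2⊢p̂ (var ∘ f) _ _) (subst-⟨⟩ 2⊢p̂ (var ∘ f) _ _))

  v̂⟨p̂,p̂⟩≈p : U ⊢ v̂ ⟨ p̂ ⟨ var 1 , var 2 ⟩ , p̂ ⟨ var 1 , var 2 ⟩ ⟩ ≈ ⟦ sep p var ⟧
  v̂⟨p̂,p̂⟩≈p = begin
    v̂ ⟨ p̂ ⟨ var 1 , var 2 ⟩ , p̂ ⟨ var 1 , var 2 ⟩ ⟩ ≈⟨ ⟨⟩-idem 2⊢v̂ v̂-idem _ ⟩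
    p̂ ⟨ var 1 , var 2 ⟩                                  ≈⟨ ⟨1,2⟩-id 2⊢p̂ ⟩
    p̂                                                    ≈⟨ subst-var p̂ ⟨
    ⟦ sep p var ⟧                                         ∎

  u-overlay : U ⊢ rename overlay u ≈ ⟦ sep p var ⟧
  u-overlay = ≈-trans (rename-u overlay) v̂⟨p̂,p̂⟩≈p

  u-cross : U ⊢ rename cross u ≈ ⟦ sep p var ⟧
  u-cross = ≈-trans (rename-u cross) (≈-trans (⟨⟩-cong 2⊢v̂ ≈-refl (≈-sym p̂-comm)) v̂⟨p̂,p̂⟩≈p)

  u-merge : U ⊢ rename merge u ≈ v̂
  u-merge = begin
    rename merge u                                        ≈⟨ rename-u merge ⟩
    v̂ ⟨ p̂ ⟨ var 1 , var 1 ⟩ , p̂ ⟨ var 2 , var 2 ⟩ ⟩ ≈⟨ ⟨⟩-cong 2⊢v̂ p̂-idem p̂-idem₂ ⟩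
    v̂ ⟨ var 1 , var 2 ⟩                                  ≈⟨ ⟨1,2⟩-id 2⊢v̂ ⟩
    v̂                                                    ∎
    where
      p̂-idem₂ : U ⊢ p̂ ⟨ var 2 , var 2 ⟩ ≈ var 2
      p̂-idem₂ = ⟨⟩-idem 2⊢p̂ p̂-idem (var 2)

  1∈p : 1 occursIn p
  1∈p = comm-idem⇒1-occurs 2⊢p consistent P1 P2

  2∈p : 2 occursIn p
  2∈p = comm-idem⇒2-occurs 2⊢p consistent P1 P2

  module _ (t : TermOf P) (s : ℕ → TermOf V) (t∈TP : TP t) (s∈TV : ∀ x → TV (s x))
           (u≈ts : U ⊢ u ≈ ⟦ sep t s ⟧) where

    renamed-separation : (f : ℕ → ℕ) {w : TermOf U} →
                         U ⊢ rename f u ≈ w → U ⊢ ⟦ sep t (rename f ∘ s) ⟧ ≈ w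
    renamed-separation f fu≈w =
      ≈-trans (≈-sym (⟦⟧-rename t s f)) (≈-trans (≈-subst (var ∘ f) (≈-sym u≈ts)) fu≈w)

    renamed-component-variable : (f : ℕ → ℕ) → U ⊢ rename f u ≈ ⟦ sep p var ⟧ →
                                 ∀ {x} → x occursIn t → ∃[ i ] [ i ]⊢ rename f (s x)
    renamed-component-variable f fu≈p {x} x∈t
      with uniqueness _ (sep t (rename f ∘ s)) (sep p var) ≈-refl (renamed-separation f fu≈p)
    ... | g , g′ , s̃ , gt≈g′p , fs≈s̃g , var≈s̃g′ =
      by-cases (rename≈rename-p⇒image stableP 2⊢p P3 t∈TP gt≈g′p g′1≢g′2 x∈t)
      where
        g′1≢g′2 : g′ 1 ≢ g′ 2
        g′1≢g′2 g′1≡g′2 = var₁≉var₂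
          (≈-trans (var≈s̃g′ 1 1∈p) (≈-trans (≡⇒≈ (cong s̃ g′1≡g′2)) (≈-sym (var≈s̃g′ 2 2∈p))))
        component : ∀ i → i occursIn p → g x ≡ g′ i → ∃[ i ] [ i ]⊢ rename f (s x)
        component i i∈p gx≡g′i = i , V2 _ (stableV (s x) f (s∈TV x)) i
          (≈-trans (var≈s̃g′ i i∈p) (≈-trans (≡⇒≈ (cong s̃ (sym gx≡g′i))) (≈-sym (fs≈s̃g x x∈t))))
        by-cases : g x ≡ g′ 1 ⊎ g x ≡ g′ 2 → ∃[ i ] [ i ]⊢ rename f (s x)
        by-cases (inj₁ gx≡g′1) = component 1 1∈p gx≡g′1
        by-cases (inj₂ gx≡g′2) = component 2 2∈p gx≡g′2

    merged-component-variable : ∀ {x} → x occursIn t →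
                                [ 1 ]⊢ rename merge (s x) ⊎ [ 2 ]⊢ rename merge (s x)
    merged-component-variable {x} x∈t = []⊢-agreement (s x) overlay cross
      (proj₂ (renamed-component-variable overlay u-overlay x∈t))
      (proj₂ (renamed-component-variable cross u-cross x∈t))

    separated-absurd : ⊥
    separated-absurd =
      absurd-at (⟦⟧≈Ŝ⇒component consistent t (rename merge ∘ s) (renamed-separation merge u-merge))
      where
        absurd-at : ∃[ x ] x occursIn t × V ⊢ v ≈ rename merge (s x) → ⊥
        absurd-at (x , x∈t , v≈merged) =
          [ proj₁ not-single , proj₂ not-single ]′ (merged-component-variable x∈t)
          where
            not-single : ¬ [ 1 ]⊢ rename merge (s x) × ¬ [ 2 ]⊢ rename merge (s x)
            not-single = V3 (rename merge (s x)) (stableV (s x) merge (s∈TV x))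
                            (≈-trans (⟨1,2⟩-id 2⊢v) v≈merged)

  absurd : ⊥
  absurd = absurd-at (separation-within universalP universalV u)
    where
      absurd-at : ∃[ t ] ∃[ s ] TP t × (∀ x → TV (s x)) × U ⊢ u ≈ ⟦ sep t s ⟧ → ⊥
      absurd-at (t , s , t∈TP , s∈TV , u≈ts) = separated-absurd t s t∈TP s∈TV u≈ts

theorem3p6 : (P V : Theory) → Consistent P →
    (TP : TermSet P) → Stable P TP → Universal P TP →
    (TV : TermSet V) → Stable V TV → Universal V TV →
    (p : TermOf P) → 2 ⊢ p → (v : TermOf V) → 2 ⊢ v →
    -- (P1)
    P ⊢ p ⟨ var 1 , var 2 ⟩ ≈ p ⟨ var 2 , var 1 ⟩ →
    -- (P2)
    P ⊢ p ⟨ var 1 , var 1 ⟩ ≈ var 1 →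
    -- (P3)
    (∀ p' → TP p' → P ⊢ p ⟨ var 1 , var 2 ⟩ ≈ p' → 2 ⊢ p') →
    -- (V1)
    V ⊢ v ⟨ var 1 , var 1 ⟩ ≈ var 1 →
    -- (V2)
    (∀ v' → TV v' → ∀ (x : ℕ) → V ⊢ var x ≈ v' → [ x ]⊢ v') →
    -- (V3)
    (∀ v' → TV v' → V ⊢ v ⟨ var 1 , var 2 ⟩ ≈ v' → ¬ ([ 1 ]⊢ v') × ¬ ([ 2 ]⊢ v')) →
    -- no composite theory of P after V
    (U : Theory) → ¬ IsComposite P V U
theorem3p6 = NoComposite.absurd
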